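{- For every $n\ge 2$, $f_5(n)\le\lceil\log_2 n\rceil+1$.
   Context: Model 5 (adaptive, three players $A,B,C$). $X$ is an $n$-element set of distinguishable elements and Player $A$ (the adversary) chooses an unknown defective element $d\in X$. Players $B$ and $C$ may agree on a (deterministic) questioning strategy before the process starts, but cannot communicate afterwards except through the rules below. At each step Player $A$ decides which of $B$ and $C$ asks the next query; a query is a subset $Q\subseteq X$, whose answer is YES iff $d\in Q$. The player asking a query obtains its answer. If the answer to a query asked by $B$ is YES, then $C$ also learns the query set and that the answer was YES; similarly for queries asked by $C$ and answered YES, $B$ learns the set and the answer. If the answer is NO, the non-asking player learns nothing (not even that a query was asked). Each player's queries may depend only on the information that player has. The goal is that at least one of $B$ and $C$ can identify $d$. $f_5(n)$ is the minimum $N$ such that $B$ and $C$ have a strategy guaranteeing that, whatever $d$ and whatever order of questioners $A$ chooses, the goal is reached after at most $N$ queries in total. -}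

module Defs where

open import Data.Nat using (ℕ)
open import Data.Bool using (Bool; true; false)
open import Data.Fin using (Fin)
open import Data.Fin.Subset using (Subset)
open import Data.Vec using (lookup)
open import Data.List using (List; []; _∷_; length)
open import Data.Product using (Σ; _×_; _,_; proj₁; proj₂)
open import Data.Sum using (_⊎_)
open import Relation.Binary.PropositionalEquality using (_≡_)

data Player : Set where
  B C : Player

-- What a questioner can observe:
--  own Q a  : the player itself asked Q and got answer a (true = YES)
--  other Q  : the other player asked Q and got answer YES
data Event (n : ℕ) : Set where
  own   : Subset n → Bool → Event n
  other : Subset n → Event n

-- A player's total information: its observations, most recent first.
View : ℕ → Set
View n = List (Event n)

Strategy : ℕ → Set
Strategy n = Player → View n → Subset n

answer : ∀ {n} → Subset n → Fin n → Bool
answer Q d = lookup Q d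

step : ∀ {n} → Strategy n → Fin n → View n × View n → Player → View n × View n
step s d (vB , vC) B with answer (s B vB) d
... | true  = (own (s B vB) true ∷ vB , other (s B vB) ∷ vC)
... | false = (own (s B vB) false ∷ vB , vC)
step s d (vB , vC) C with answer (s C vC) d
... | true  = (other (s C vC) ∷ vB , own (s C vC) true ∷ vC)
... | false = (vB , own (s C vC) false ∷ vC)

-- Views of (B , C) after the questioner sequence ω (ω lists the
-- questioners most recent first) when the defective element is d.
run : ∀ {n} → Strategy n → Fin n → List Player → View n × View n
run s d []      = ([] , [])
run s d (p ∷ ω) = step s d (run s d ω) p

viewOf : ∀ {n} → Player → View n × View n → View n
viewOf B v = proj₁ v
viewOf C v = proj₂ v

Identifies : ∀ {n} → Strategy n → Player → Fin n → List Player → Set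
Identifies s p d ω =
  ∀ d' (ω' : List Player) → viewOf p (run s d' ω') ≡ viewOf p (run s d ω) → d' ≡ d

Succeeds : ∀ {n} → Strategy n → ℕ → Set
Succeeds s N = ∀ d (ω : List Player) → length ω ≡ N → Identifies s B d ω ⊎ Identifies s C d ω

f5≤ : ℕ → ℕ → Set
f5≤ n N = Σ (Strategy n) λ s → Succeeds s N

{-# OPTIONS --safe #-}
-- Identify the elements of X with their ⌈log₂ n⌉-bit binary codes. B determines the bits
-- from the first one on and C from the last one on: each player asks whether its first
-- unknown bit is 0 (for B) or 1 (for C), restricted to the elements consistent with what
-- it knows. A NO answer teaches the asker that bit. A YES answer is seen by both players,
-- who then learn every bit on which all members of the query agree, i.e. everything the
-- asker knew together with the queried bit. So every query lengthens the prefix known to B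
-- or the suffix known to C, and after ⌈log₂ n⌉ queries the two cover all bits.
-- Moreover a bit known to one player only was learned from a NO answer, so its value is
-- the opposite of what that player asks about. The next query is about a bit that the
-- partner already knows in this way, hence it is answered YES and completes the partner's
-- knowledge.
module Submission where

open import Defs

open import Data.Bool using (Bool; true; false; not)
open import Data.Bool.Properties using (¬-not) renaming (_≟_ to _≟ᵇ_)
open import Data.Fin as Fin using (Fin; toℕ; fromℕ<; inject; inject≤; opposite; finToFun; funToFin; combine)
open import Data.Fin.Properties
  using (all?; ¬∀⟶∃¬-smallest; toℕ-injective; toℕ-inject; toℕ-fromℕ<; toℕ<n; opposite-prop;
         opposite-involutive; inject≤-injective; funToFin-finToFin; 2↔Bool)
open import Data.Fin.Subset using (Subset; ⊤)
open import Data.List using ([]; _∷_; length; foldr)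
open import Data.Maybe using (Maybe; just; nothing; _<∣>_)
open import Data.Maybe.Relation.Unary.All as All using (All; drop-just)
open import Data.Nat using (ℕ; zero; suc; _+_; _^_; _≤_; _<_; z≤n; s≤s; ⌊_/2⌋; ⌈_/2⌉)
open import Data.Nat.Properties
  using (≤-refl; ≤-trans; <⇒≤; ≮⇒≥; <-cmp; m≤n⇒m<n∨m≡n; +-comm; +-suc; +-identityʳ; +-monoˡ-≤;
         +-mono-≤; +-cancelˡ-≤; m+[n∸m]≡n; suc-injective; ⌊n/2⌋≤⌈n/2⌉; ⌊n/2⌋+⌈n/2⌉≡n; ⌈n/2⌉<n;
         module ≤-Reasoning)
open import Data.Nat.Logarithm using (⌈log₂_⌉; ⌈log₂⌈n/2⌉⌉≡⌈log₂n⌉∸1)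
open import Data.Nat.Induction using (<-rec)
open import Data.Product using (∃; _×_; _,_; proj₁; proj₂; uncurry)
open import Data.Sum using (_⊎_; inj₁; inj₂)
open import Data.Vec using (lookup; tabulate)
open import Data.Vec.Properties using (lookup∘tabulate)
open import Data.Vec.Functional using (updateAt)
open import Data.Vec.Functional.Properties using (updateAt-updates; updateAt-minimal)
open import Function using (_∘_; id; const)
open import Function.Bundles using (Injection)
open import Function.Properties.Inverse using (↔⇒↣)
open import Relation.Binary.Definitions using (Tri; tri<; tri≈; tri>)
open import Relation.Binary.PropositionalEquality
open import Relation.Nullary using (Dec; yes; no; ¬_; does; contradiction)
open import Relation.Nullary.Decidable using (_×-dec_; _→-dec_; dec-true)
open import Relation.Unary using (Pred; Decidable)

n≤2^⌈log₂n⌉ : ∀ n → n ≤ 2 ^ ⌈log₂ n ⌉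
n≤2^⌈log₂n⌉ = <-rec _ bound
  where
  bound : ∀ n → (∀ {m} → m < n → m ≤ 2 ^ ⌈log₂ m ⌉) → n ≤ 2 ^ ⌈log₂ n ⌉
  bound 0 _ = z≤n
  bound 1 _ = s≤s z≤n
  bound n@(suc (suc m)) rec = begin
    n                    ≡⟨ ⌊n/2⌋+⌈n/2⌉≡n n ⟨
    ⌊ n /2⌋ + ⌈ n /2⌉    ≤⟨ +-monoˡ-≤ ⌈ n /2⌉ (⌊n/2⌋≤⌈n/2⌉ n) ⟩
    ⌈ n /2⌉ + ⌈ n /2⌉    ≤⟨ +-mono-≤ half half ⟩
    2 ^ l + 2 ^ l        ≡⟨ cong (2 ^ l +_) (+-identityʳ (2 ^ l)) ⟨
    2 ^ suc l            ≡⟨ cong (λ e → 2 ^ suc e) (⌈log₂⌈n/2⌉⌉≡⌈log₂n⌉∸1 n) ⟩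
    2 ^ ⌈log₂ n ⌉        ∎
    where
    -- The last step holds since suc (⌈log₂ n ⌉ ∸ 1) reduces to ⌈log₂ n ⌉ for n ≥ 2.
    open ≤-Reasoning
    l : ℕ
    l = ⌈log₂ ⌈ n /2⌉ ⌉
    half : ⌈ n /2⌉ ≤ 2 ^ l
    half = rec (⌈n/2⌉<n m)

funToFin-cong : ∀ {m n} {f g : Fin m → Fin n} → (∀ i → f i ≡ g i) → funToFin f ≡ funToFin g
funToFin-cong {zero}  _   = refl
funToFin-cong {suc m} f≗g = cong₂ combine (f≗g Fin.zero) (funToFin-cong (f≗g ∘ Fin.suc))

binary : ∀ k → Fin (2 ^ k) → Fin k → Bool
binary k x = Injection.to (↔⇒↣ 2↔Bool) ∘ finToFun x

binary-injective : ∀ k {x y} → (∀ j → binary k x j ≡ binary k y j) → x ≡ y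
binary-injective k {x} {y} same = begin
  x                              ≡⟨ funToFin-finToFin {k} {2} x ⟨
  funToFin (finToFun {2} {k} x)  ≡⟨ funToFin-cong (Injection.injective (↔⇒↣ 2↔Bool) ∘ same) ⟩
  funToFin (finToFun {2} {k} y)  ≡⟨ funToFin-finToFin {k} {2} y ⟩
  y                              ∎
  where open ≡-Reasoning

code : ∀ n → Fin n → Fin ⌈log₂ n ⌉ → Bool
code n x = binary ⌈log₂ n ⌉ (inject≤ x (n≤2^⌈log₂n⌉ n))

code-injective : ∀ n {x y} → (∀ j → code n x j ≡ code n y j) → x ≡ y
code-injective n {x} {y} = inject≤-injective _ _ x y ∘ binary-injective ⌈log₂ n ⌉

dec-true⁻ : ∀ {a} {A : Set a} (a? : Dec A) → does a? ≡ true → A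
dec-true⁻ (yes a) _ = a

¬∀⟶∃¬-least : ∀ {m p} (P : Pred (Fin m) p) → Decidable P → ¬ (∀ i → P i) →
              ∃ λ i → ¬ P i × (∀ j → toℕ j < toℕ i → P j)
¬∀⟶∃¬-least {m} P P? ¬∀P with ¬∀⟶∃¬-smallest m P P? ¬∀P
... | i , ¬Pi , below = i , ¬Pi , λ j j<i → subst P (inject-fromℕ< j j<i) (below (fromℕ< j<i))
  where
  inject-fromℕ< : ∀ j (j<i : toℕ j < toℕ i) → inject {i = i} (fromℕ< j<i) ≡ j
  inject-fromℕ< j j<i = toℕ-injective (trans (toℕ-inject (fromℕ< j<i)) (toℕ-fromℕ< j<i))

partner : Player → Player
partner B = C
partner C = B

both-players : ∀ {P : Player → Set} p → P p → P (partner p) → ∀ q → P q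
both-players B x y B = x
both-players B x y C = y
both-players C x y B = y
both-players C x y C = x

both-roles : ∀ {R : Player → Player → Set} p → R p (partner p) → R (partner p) p → ∀ q → R q (partner q)
both-roles B x y B = x
both-roles B x y C = y
both-roles C x y B = y
both-roles C x y C = x

partner-role : ∀ {R : Player → Player → Set} → (∀ q → R q (partner q)) → ∀ p → R (partner p) p
partner-role r B = r C
partner-role r C = r B

probe : Player → Bool
probe B = false
probe C = true

not-probe-partner : ∀ p → not (probe (partner p)) ≡ probe p
not-probe-partner B = refl
not-probe-partner C = refl

order : ∀ {k} → Player → Fin k → Fin k
order B = id
order C = opposite

rank : ∀ {k} → Player → Fin k → ℕ
rank p = toℕ ∘ order p

order-involutive : ∀ {k} p (j : Fin k) → order p (order p j) ≡ j
order-involutive B j = refl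
order-involutive C j = opposite-involutive j

rank-injective : ∀ {k} p {i j : Fin k} → rank p i ≡ rank p j → i ≡ j
rank-injective p {i} {j} eq = begin
  i                      ≡⟨ order-involutive p i ⟨
  order p (order p i)    ≡⟨ cong (order p) (toℕ-injective eq) ⟩
  order p (order p j)    ≡⟨ order-involutive p j ⟩
  j                      ∎
  where open ≡-Reasoning

rank-partner : ∀ {k} p (j : Fin k) → suc (rank p j + rank (partner p) j) ≡ k
rank-partner B j = trans (cong (suc (toℕ j) +_) (opposite-prop j)) (m+[n∸m]≡n (toℕ<n j))
rank-partner C j = trans (cong suc (+-comm (toℕ (opposite j)) (toℕ j))) (rank-partner B j)

rank-partner-< : ∀ {k a c} p (j : Fin k) → k ≤ a + c → a ≤ rank p j → rank (partner p) j < c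
rank-partner-< {k} {a} {c} p j k≤a+c a≤rank = +-cancelˡ-≤ a _ _ (begin
  a + suc (rank (partner p) j)         ≤⟨ +-monoˡ-≤ _ a≤rank ⟩
  rank p j + suc (rank (partner p) j)  ≡⟨ +-suc (rank p j) _ ⟩
  suc (rank p j + rank (partner p) j)  ≡⟨ rank-partner p j ⟩
  k                                    ≤⟨ k≤a+c ⟩
  a + c                                ∎)
  where open ≤-Reasoning

module BitsFromBothEnds {n k : ℕ} (bit : Fin n → Fin k → Bool)
                        (bit-injective : ∀ {x y} → (∀ j → bit x j ≡ bit y j) → x ≡ y) where

  Knowledge : Set
  Knowledge = Fin k → Maybe Bool

  record Known (α : Knowledge) (j : Fin k) : Set where
    constructor known
    field
      value : Bool
      is    : α j ≡ just value

  known? : ∀ α → Decidable (Known α)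
  known? α j with α j in eq
  ... | just b  = yes (known b eq)
  ... | nothing = no λ { (known _ eq′) → contradiction (trans (sym eq) eq′) λ () }

  Complete : Knowledge → Set
  Complete α = ∀ j → Known α j

  Satisfies : Fin n → Knowledge → Set
  Satisfies x α = ∀ j → All (bit x j ≡_) (α j)

  satisfies? : ∀ x α → Dec (Satisfies x α)
  satisfies? x α = all? λ j → All.dec (bit x j ≟ᵇ_) (α j)

  satisfies-just : ∀ {x α j b} → Satisfies x α → α j ≡ just b → bit x j ≡ b
  satisfies-just {j = j} sat eq = drop-just (subst (All _) eq (sat j))

  complete-satisfies-unique : ∀ {α x y} → Complete α → Satisfies x α → Satisfies y α → x ≡ y
  complete-satisfies-unique all-known satx saty = bit-injective λ j →
    trans (satisfies-just satx (Known.is (all-known j))) (sym (satisfies-just saty (Known.is (all-known j))))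

  infixl 6 _⊔_
  _⊔_ : Knowledge → Knowledge → Knowledge
  (α ⊔ β) j = α j <∣> β j

  known-⊔ˡ : ∀ {α β j} → Known α j → Known (α ⊔ β) j
  known-⊔ˡ {β = β} {j} (known b eq) = known b (cong (_<∣> β j) eq)

  known-⊔ʳ : ∀ {α β j} → Known β j → Known (α ⊔ β) j
  known-⊔ʳ {α} {β} {j} (known b eq) with α j in eqα
  ... | just c  = known c (cong (_<∣> β j) eqα)
  ... | nothing = known b (trans (cong (_<∣> β j) eqα) eq)

  known-⊔⁻ : ∀ {α β j} → Known (α ⊔ β) j → Known α j ⊎ Known β j
  known-⊔⁻ {α} {β} {j} (known b eq) with α j in eqα
  ... | just c  = inj₁ (known c eqα)
  ... | nothing = inj₂ (known b eq)

  satisfies-⊔ : ∀ {x α β} → Satisfies x α → Satisfies x β → Satisfies x (α ⊔ β)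
  satisfies-⊔ {α = α} satα satβ j with α j | satα j
  ... | just _  | sat = sat
  ... | nothing | _   = satβ j

  Unanimous : Subset n → Fin k → Bool → Set
  Unanimous Q j b = ∀ x → lookup Q x ≡ true → bit x j ≡ b

  unanimous? : ∀ Q j b → Dec (Unanimous Q j b)
  unanimous? Q j b = all? λ x → (lookup Q x ≟ᵇ true) →-dec (bit x j ≟ᵇ b)

  agreed : Subset n → Knowledge
  agreed Q j with unanimous? Q j true | unanimous? Q j false
  ... | yes _ | _     = just true
  ... | no _  | yes _ = just false
  ... | no _  | no _  = nothing

  satisfies-agreed : ∀ {x Q} → lookup Q x ≡ true → Satisfies x (agreed Q)
  satisfies-agreed {x} {Q} x∈Q j with unanimous? Q j true | unanimous? Q j false
  ... | yes u | _     = All.just (u x x∈Q)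
  ... | no _  | yes u = All.just (u x x∈Q)
  ... | no _  | no _  = All.nothing

  agreed-just : ∀ {Q j b} → Unanimous Q j b → ∃ λ c → agreed Q j ≡ just c
  agreed-just {Q} {j} u with unanimous? Q j true | unanimous? Q j false
  ... | yes _ | _     = true , refl
  ... | no _  | yes _ = false , refl
  agreed-just {b = true}  u | no ¬u | no _  = contradiction u ¬u
  agreed-just {b = false} u | no _  | no ¬u = contradiction u ¬u

  known-agreed : ∀ {Q j b} → Unanimous Q j b → Known (agreed Q) j
  known-agreed u = uncurry known (agreed-just u)

  assign : Knowledge → Fin k → Bool → Knowledge
  assign α i b = updateAt α i (const (just b))

  satisfies-assign : ∀ {x α i b} → Satisfies x α → bit x i ≡ b → Satisfies x (assign α i b)
  satisfies-assign {α = α} {i} {b} sat bitᵢ j with j Fin.≟ i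
  ... | yes refl = subst (All _) (sym (updateAt-updates i α)) (All.just bitᵢ)
  ... | no j≢i   = subst (All _) (sym (updateAt-minimal j i α j≢i)) (sat j)

  known-assign-here : ∀ {α i b} → Known (assign α i b) i
  known-assign-here {α} {i} {b} = known b (updateAt-updates i α)

  known-assign : ∀ {α i b j} → Known α j → Known (assign α i b) j
  known-assign {α} {i} {b} {j} (known c eq) with j Fin.≟ i
  ... | yes refl = known-assign-here
  ... | no j≢i   = known c (trans (updateAt-minimal j i α j≢i) eq)

  assign-fresh : ∀ {α i b j} → Known (assign α i b) j → ¬ Known α j → assign α i b j ≡ just b
  assign-fresh {α} {i} {b} {j} (known c eq) ¬known with j Fin.≟ i
  ... | yes refl = updateAt-updates i α
  ... | no j≢i   = contradiction (known c (trans (sym (updateAt-minimal j i α j≢i)) eq)) ¬known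

  data Frontier (p : Player) (α : Knowledge) : Set where
    complete : Complete α → Frontier p α
    openAt   : ∀ i → ¬ Known α i → (∀ j → rank p j < rank p i → Known α j) → Frontier p α

  known-reordered : ∀ α p j → Known α (order p (order p j)) → Known α j
  known-reordered α p j = subst (Known α) (order-involutive p j)

  scan : ∀ p α → Frontier p α
  scan p α with all? (known? α)
  ... | yes all-known = complete all-known
  ... | no ¬all-known with ¬∀⟶∃¬-least (Known α ∘ order p) (known? α ∘ order p)
                             (λ all-known → ¬all-known λ j → known-reordered α p j (all-known (order p j)))
  ...   | r , unknown , below = openAt (order p r) unknown λ j j<r →
          known-reordered α p j (below (order p j) (subst (rank p j <_) (cong toℕ (order-involutive p r)) j<r))

  probeSet : Player → Knowledge → Fin k → Subset n
  probeSet p α i = tabulate λ x → does (satisfies? x α ×-dec bit x i ≟ᵇ probe p)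

  ∈-probeSet⁺ : ∀ {p α i x} → Satisfies x α → bit x i ≡ probe p → lookup (probeSet p α i) x ≡ true
  ∈-probeSet⁺ {p} {α} {i} {x} sat bitᵢ =
    trans (lookup∘tabulate _ x) (dec-true (satisfies? x α ×-dec bit x i ≟ᵇ probe p) (sat , bitᵢ))

  ∈-probeSet⁻ : ∀ {p α i x} → lookup (probeSet p α i) x ≡ true → Satisfies x α × bit x i ≡ probe p
  ∈-probeSet⁻ {p} {α} {i} {x} x∈Q =
    dec-true⁻ (satisfies? x α ×-dec bit x i ≟ᵇ probe p) (trans (sym (lookup∘tabulate _ x)) x∈Q)

  known-agreed-probeSet : ∀ {p α i j} → Known α j → Known (agreed (probeSet p α i)) j
  known-agreed-probeSet (known b eq) = known-agreed λ _ x∈Q → satisfies-just (proj₁ (∈-probeSet⁻ x∈Q)) eq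

  known-agreed-probeSet-here : ∀ {p α i} → Known (agreed (probeSet p α i)) i
  known-agreed-probeSet-here = known-agreed λ _ x∈Q → proj₂ (∈-probeSet⁻ x∈Q)

  -- Once every bit is known, any query will do.
  query : Player → Knowledge → Subset n
  query p α with scan p α
  ... | complete _   = ⊤
  ... | openAt i _ _ = probeSet p α i

  learnYes : Subset n → Knowledge → Knowledge
  learnYes Q α = α ⊔ agreed Q

  learnNo : Player → Knowledge → Knowledge
  learnNo p α with scan p α
  ... | complete _   = α
  ... | openAt i _ _ = assign α i (not (probe p))

  learn : Player → Event n → Knowledge → Knowledge
  learn p (own Q true)  = learnYes Q
  learn p (own Q false) = learnNo p
  learn p (other Q)     = learnYes Q

  know : Player → View n → Knowledge
  know p = foldr (learn p) (const nothing)

  strategy : Strategy n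
  strategy p v = query p (know p v)

  satisfies-learnYes : ∀ {x Q α} → lookup Q x ≡ true → Satisfies x α → Satisfies x (learnYes Q α)
  satisfies-learnYes x∈Q sat = satisfies-⊔ sat (satisfies-agreed x∈Q)

  satisfies-learnNo : ∀ {x p α} → Satisfies x α → lookup (query p α) x ≡ false → Satisfies x (learnNo p α)
  satisfies-learnNo {x} {p} {α} sat x∉Q with scan p α
  ... | complete _   = sat
  ... | openAt i _ _ = satisfies-assign sat (¬-not λ bitᵢ → contradiction (trans (sym (∈-probeSet⁺ sat bitᵢ)) x∉Q) λ ())

  known-learnNo : ∀ {p α j} → Known α j → Known (learnNo p α) j
  known-learnNo {p} {α} is-known with scan p α
  ... | complete _   = is-known
  ... | openAt i _ _ = known-assign is-known

  learnNo-fresh : ∀ {p α j} → Known (learnNo p α) j → ¬ Known α j → learnNo p α j ≡ just (not (probe p))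
  learnNo-fresh {p} {α} {j} is-known ¬known with scan p α
  ... | complete all-known = contradiction (all-known j) ¬known
  ... | openAt i _ _       = assign-fresh is-known ¬known

  -- Knowledge (α , β) of the asker p and its partner before a query, and (α′ , β′) after it.
  data Transition (d : Fin n) (p : Player) (α β : Knowledge) : Knowledge → Knowledge → Set where
    confirmed : lookup (query p α) d ≡ true →
                Transition d p α β (learnYes (query p α) α) (learnYes (query p α) β)
    refuted   : lookup (query p α) d ≡ false → Transition d p α β (learnNo p α) β

  transition-satisfies : ∀ {d p α β α′ β′} → Transition d p α β α′ β′ →
                         Satisfies d α → Satisfies d β → Satisfies d α′ × Satisfies d β′
  transition-satisfies (confirmed d∈Q) satα satβ = satisfies-learnYes d∈Q satα , satisfies-learnYes d∈Q satβ
  transition-satisfies (refuted d∉Q)   satα satβ = satisfies-learnNo satα d∉Q , satβ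

  transition-known : ∀ {d p α β α′ β′} → Transition d p α β α′ β′ →
                     (∀ j → Known α j → Known α′ j) × (∀ j → Known β j → Known β′ j)
  transition-known (confirmed _) = (λ _ → known-⊔ˡ) , (λ _ → known-⊔ˡ)
  transition-known (refuted _)   = (λ _ → known-learnNo) , (λ _ → id)

  Exclusive : Fin n → Player → Knowledge → Knowledge → Set
  Exclusive d p α β = ∀ j → Known α j → ¬ Known β j → bit d j ≡ not (probe p)

  exclusive-learnYes : ∀ {d p α β Q} → Exclusive d p α β → Exclusive d p (learnYes Q α) (learnYes Q β)
  exclusive-learnYes excl j knownα′ ¬knownβ′ with known-⊔⁻ knownα′
  ... | inj₁ knownα = excl j knownα (¬knownβ′ ∘ known-⊔ˡ)
  ... | inj₂ knownQ = contradiction (known-⊔ʳ knownQ) ¬knownβ′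

  transition-exclusive : ∀ {d p α β α′ β′} → Transition d p α β α′ β′ → Satisfies d α′ →
                         Exclusive d p α β → Exclusive d (partner p) β α →
                         Exclusive d p α′ β′ × Exclusive d (partner p) β′ α′
  transition-exclusive (confirmed _) _ exclα exclβ = exclusive-learnYes exclα , exclusive-learnYes exclβ
  transition-exclusive {d} {p} {α} {β} (refuted _) satα′ exclα exclβ = exclα′ , exclβ′
    where
    exclα′ : Exclusive d p (learnNo p α) β
    exclα′ j knownα′ ¬knownβ with known? α j
    ... | yes knownα = exclα j knownα ¬knownβ
    ... | no ¬knownα = satisfies-just satα′ (learnNo-fresh knownα′ ¬knownα)
    exclβ′ : Exclusive d (partner p) β (learnNo p α)
    exclβ′ j knownβ ¬knownα′ = exclβ j knownβ (¬knownα′ ∘ known-learnNo)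

  Prefix : Player → ℕ → Knowledge → Set
  Prefix p a α = ∀ j → rank p j < a → Known α j

  prefix-≤-rank : ∀ p {a α i} → Prefix p a α → ¬ Known α i → a ≤ rank p i
  prefix-≤-rank _ prefix ¬known = ≮⇒≥ (¬known ∘ prefix _)

  prefix-extend : ∀ p {a α α′ i} → (∀ j → Known α j → Known α′ j) → ¬ Known α i →
                  (∀ j → rank p j < rank p i → Known α j) → Known α′ i →
                  Prefix p a α → ∃ λ a′ → a < a′ × Prefix p a′ α′
  prefix-extend p {α′ = α′} {i} grow unknown below knownᵢ prefix =
    suc (rank p i) , s≤s (prefix-≤-rank p prefix unknown) , extended
    where
    extended : Prefix p (suc (rank p i)) α′
    extended j (s≤s j≤i) with m≤n⇒m<n∨m≡n j≤i
    ... | inj₁ j<i = grow j (below j j<i)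
    ... | inj₂ j=i = subst (Known α′) (sym (rank-injective p j=i)) knownᵢ

  transition-advance : ∀ {d p α β α′ β′ a} → Transition d p α β α′ β′ → Prefix p a α →
                       Complete α′ ⊎ ∃ λ a′ → a < a′ × Prefix p a′ α′
  transition-advance {p = p} {α} (confirmed _) prefix with scan p α
  ... | complete all-known     = inj₁ (known-⊔ˡ ∘ all-known)
  ... | openAt i unknown below =
        inj₂ (prefix-extend p (λ _ → known-⊔ˡ) unknown below (known-⊔ʳ known-agreed-probeSet-here) prefix)
  transition-advance {p = p} {α} (refuted _) prefix with scan p α
  ... | complete all-known     = inj₁ all-known
  ... | openAt i unknown below = inj₂ (prefix-extend p (λ _ → known-assign) unknown below known-assign-here prefix)

  prefix-handover : ∀ p {a c α β i j} → Prefix p a α → Prefix (partner p) c β → k ≤ a + c →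
                    ¬ Known α i → rank p i ≤ rank p j → Known β j
  prefix-handover p {j = j} prefixα prefixβ k≤a+c unknown i≤j =
    prefixβ j (rank-partner-< p j k≤a+c (≤-trans (prefix-≤-rank p prefixα unknown) i≤j))

  transition-finish : ∀ {d p α β α′ β′ a c} → Transition d p α β α′ β′ → Satisfies d α →
                      Exclusive d (partner p) β α → Prefix p a α → Prefix (partner p) c β → k ≤ a + c →
                      Complete α′ ⊎ Complete β′
  transition-finish {d} {p} {α} (refuted d∉Q) satα exclβ prefixα prefixβ k≤a+c with scan p α
  ... | complete all-known = inj₁ all-known
  ... | openAt i unknown _ = contradiction (trans (sym (∈-probeSet⁺ satα bitᵢ)) d∉Q) λ ()
    where
    bitᵢ : bit d i ≡ probe p
    bitᵢ = trans (exclβ i (prefix-handover p prefixα prefixβ k≤a+c unknown ≤-refl) unknown) (not-probe-partner p)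
  transition-finish {d} {p} {α} {β} (confirmed _) satα exclβ prefixα prefixβ k≤a+c with scan p α
  ... | complete all-known     = inj₁ (known-⊔ˡ ∘ all-known)
  ... | openAt i unknown below = inj₂ λ j → known-at j (<-cmp (rank p j) (rank p i))
    where
    known-at : ∀ j → Tri (rank p j < rank p i) (rank p j ≡ rank p i) (rank p i < rank p j) →
               Known (learnYes (probeSet p α i) β) j
    known-at j (tri< j<i _ _) = known-⊔ʳ (known-agreed-probeSet (below j j<i))
    known-at j (tri≈ _ j=i _) = subst (Known _) (sym (rank-injective p j=i)) (known-⊔ʳ known-agreed-probeSet-here)
    known-at j (tri> _ _ i<j) = known-⊔ˡ (prefix-handover p prefixα prefixβ k≤a+c unknown (<⇒≤ i<j))

  State : Set
  State = View n × View n

  knowledge : State → Player → Knowledge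
  knowledge st p = know p (viewOf p st)

  transition : ∀ d st p → Transition d p (knowledge st p) (knowledge st (partner p))
                                         (knowledge (step strategy d st p) p)
                                         (knowledge (step strategy d st p) (partner p))
  transition d (vB , vC) B with answer (strategy B vB) d in eq
  ... | true  = confirmed eq
  ... | false = refuted eq
  transition d (vB , vC) C with answer (strategy C vC) d in eq
  ... | true  = confirmed eq
  ... | false = refuted eq

  ExclusiveIn : Fin n → State → Player → Player → Set
  ExclusiveIn d st p q = Exclusive d p (knowledge st p) (knowledge st q)

  record Invariant (d : Fin n) (st : State) : Set where
    field
      sound     : ∀ p → Satisfies d (knowledge st p)
      exclusive : ∀ p → ExclusiveIn d st p (partner p)

  invariant-initial : ∀ d → Invariant d ([] , [])
  invariant-initial d = record
    { sound     = λ { B _ → All.nothing ; C _ → All.nothing }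
    ; exclusive = λ { B _ (known _ ()) _ ; C _ (known _ ()) _ }
    }

  invariant-step : ∀ d p {st} → Invariant d st → Invariant d (step strategy d st p)
  invariant-step d p {st} inv = record
    { sound     = uncurry (both-players p) sound′
    ; exclusive = uncurry (both-roles {R = ExclusiveIn d st′} p) exclusive′
    }
    where
    open Invariant inv
    st′ : State
    st′ = step strategy d st p
    sound′ : Satisfies d (knowledge st′ p) × Satisfies d (knowledge st′ (partner p))
    sound′ = transition-satisfies (transition d st p) (sound p) (sound (partner p))
    exclusive′ : ExclusiveIn d st′ p (partner p) × ExclusiveIn d st′ (partner p) p
    exclusive′ = transition-exclusive (transition d st p) (proj₁ sound′) (exclusive p)
                   (partner-role {R = ExclusiveIn d st} exclusive p)

  known-step : ∀ d p st q j → Known (knowledge st q) j → Known (knowledge (step strategy d st p) q) j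
  known-step d p st = uncurry (both-players p) (transition-known (transition d st p))

  Done : State → Set
  Done st = ∃ λ p → Complete (knowledge st p)

  done-step : ∀ d p {st} → Done st → Done (step strategy d st p)
  done-step d p {st} (q , all-known) = q , λ j → known-step d p st q j (all-known j)

  record Budget (st : State) (m : ℕ) (p q : Player) : Set where
    constructor budget
    field
      {a c}   : ℕ
      prefix₁ : Prefix p a (knowledge st p)
      prefix₂ : Prefix q c (knowledge st q)
      bound   : m ≤ a + c

  budget-swap : ∀ {st m p q} → Budget st m p q → Budget st m q p
  budget-swap {m = m} (budget {a} {c} prefix₁ prefix₂ m≤a+c) =
    budget prefix₂ prefix₁ (subst (m ≤_) (+-comm a c) m≤a+c)

  Progress : State → ℕ → Set
  Progress st m = Done st ⊎ (∀ p → Budget st m p (partner p))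

  progress-initial : Progress ([] , []) 0
  progress-initial = inj₂ λ _ → budget {a = 0} {0} (λ _ ()) (λ _ ()) z≤n

  progress-step : ∀ d p {st m} → Progress st m → Progress (step strategy d st p) (suc m)
  progress-step d p (inj₁ done) = inj₁ (done-step d p done)
  progress-step d p {st} {m} (inj₂ budgets) with budgets p
  ... | budget {a} {c} prefixα prefixβ m≤a+c with transition-advance (transition d st p) prefixα
  ...   | inj₁ all-known              = inj₁ (p , all-known)
  ...   | inj₂ (a′ , a<a′ , prefixα′) =
          inj₂ (both-roles {R = Budget (step strategy d st p) (suc m)} p budget′ (budget-swap budget′))
    where
    budget′ : Budget (step strategy d st p) (suc m) p (partner p)
    budget′ = budget prefixα′ (λ j → known-step d p st (partner p) j ∘ prefixβ j)
                     (≤-trans (s≤s m≤a+c) (+-monoˡ-≤ c a<a′))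

  done-after-budget : ∀ d p {st} → Invariant d st → Budget st k p (partner p) → Done (step strategy d st p)
  done-after-budget d p {st} inv (budget prefixα prefixβ k≤a+c)
    with transition-finish (transition d st p) (Invariant.sound inv p)
           (partner-role {R = ExclusiveIn d st} (Invariant.exclusive inv) p) prefixα prefixβ k≤a+c
  ... | inj₁ all-known = p , all-known
  ... | inj₂ all-known = partner p , all-known

  run-invariant : ∀ d ω → Invariant d (run strategy d ω)
  run-invariant d []      = invariant-initial d
  run-invariant d (p ∷ ω) = invariant-step d p (run-invariant d ω)

  run-progress : ∀ d ω → Progress (run strategy d ω) (length ω)
  run-progress d []      = progress-initial
  run-progress d (p ∷ ω) = progress-step d p (run-progress d ω)

  complete-identifies : ∀ d ω p → Complete (knowledge (run strategy d ω) p) → Identifies strategy p d ω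
  complete-identifies d ω p all-known d′ ω′ same = complete-satisfies-unique all-known
    (subst (λ v → Satisfies d′ (know p v)) same (Invariant.sound (run-invariant d′ ω′) p))
    (Invariant.sound (run-invariant d ω) p)

  done-after : ∀ d p ω → length ω ≡ k → Done (run strategy d (p ∷ ω))
  done-after d p ω len with run-progress d ω
  ... | inj₁ done    = done-step d p done
  ... | inj₂ budgets = done-after-budget d p (run-invariant d ω)
                         (subst (λ m → Budget (run strategy d ω) m p (partner p)) len (budgets p))

  succeeds : Succeeds strategy (k + 1)
  succeeds d []      len = contradiction (trans len (+-comm k 1)) λ ()
  succeeds d (p ∷ ω) len with done-after d p ω (suc-injective (trans len (+-comm k 1)))
  ... | B , all-known = inj₁ (complete-identifies d (p ∷ ω) B all-known)
  ... | C , all-known = inj₂ (complete-identifies d (p ∷ ω) C all-known)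

proposition5 : (n : ℕ) → 2 ≤ n → f5≤ n (⌈log₂ n ⌉ + 1)
proposition5 n _ = strategy , succeeds
  where open BitsFromBothEnds (code n) (code-injective n)
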